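{- Let $\ell\leq\beta$ be positive integers, $k\geq5$, and $a,b\in\{0,1\}^{\ell\times\ell}$, and let $G=G(\ell,\beta)$ be the directed graph described in the context. If $a$ and $b$ are disjoint, then $G$ has a directed $k$-spanner with at most $7\ell\beta$ edges. Otherwise, every directed $k$-spanner of $G$ contains at least $\beta^2$ edges of $D$.
   Context: The directed graph $G(\ell,\beta)$ has vertices $x^1_i,x^2_i,y^1_i,y^2_i,y^3_i$ for $1\leq i\leq\ell$ and $x_{ij},y_{ij}$ for $1\leq i\leq\ell$, $1\leq j\leq\beta$. Its directed edges are: $(x^1_i,y^1_i)$ and $(x^2_i,y^2_i)$ for all $i$; the set $D$ of all edges $(x_{ij},y_{rs})$ for all $1\leq i,r\leq\ell$, $1\leq j,s\leq\beta$; $(x_{ij},x^1_i)$ for all $i,j$; $(y^3_i,y_{ij})$ for all $i,j$; $(y^2_i,y^3_i)$ for all $i$; the edge $(x^1_i,x^2_j)$ if and only if $a_{ij}=0$; and the edge $(y^1_i,y^2_j)$ if and only if $b_{ij}=0$. The inputs $a,b$ are disjoint if there is no pair $(i,j)$ with $a_{ij}=b_{ij}=1$. A directed $k$-spanner of $G$ is a subgraph $H$ such that every edge $(u,v)$ of $G$ has a directed path with at most $k$ edges from $u$ to $v$ in $H$. -}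

module Defs where

open import Data.Nat using (ℕ; zero; suc; _≤_; _*_)
open import Data.Fin using (Fin)
open import Data.Bool using (Bool; true; false)
open import Data.Product using (_×_; _,_; Σ; ∃; proj₁; proj₂)
open import Data.List using (List; length; filterᵇ)
open import Data.List.Membership.Propositional using (_∈_)
open import Data.List.Relation.Unary.Unique.Propositional using (Unique)
open import Relation.Binary.PropositionalEquality using (_≡_)
open import Relation.Nullary using (¬_)

-- 0/1 matrices of size ℓ × ℓ; the entry value 0 is `false`, 1 is `true`.
Matrix : ℕ → Set
Matrix ℓ = Fin ℓ → Fin ℓ → Bool

Disjoint : {ℓ : ℕ} → Matrix ℓ → Matrix ℓ → Set
Disjoint {ℓ} a b = ¬ (Σ (Fin ℓ) λ i → Σ (Fin ℓ) λ j → (a i j ≡ true) × (b i j ≡ true))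

data Vertex (ℓ β : ℕ) : Set where
  x¹ x² y¹ y² y³ : Fin ℓ → Vertex ℓ β
  x y : Fin ℓ → Fin β → Vertex ℓ β

data Edge {ℓ β : ℕ} (a b : Matrix ℓ) : Vertex ℓ β → Vertex ℓ β → Set where
  e-x¹y¹ : ∀ i → Edge a b (x¹ i) (y¹ i)
  e-x²y² : ∀ i → Edge a b (x² i) (y² i)
  e-D    : ∀ i j r s → Edge a b (x i j) (y r s)
  e-xx¹  : ∀ i j → Edge a b (x i j) (x¹ i)
  e-y³y  : ∀ i j → Edge a b (y³ i) (y i j)
  e-y²y³ : ∀ i → Edge a b (y² i) (y³ i)
  e-a    : ∀ i j → a i j ≡ false → Edge a b (x¹ i) (x² j)
  e-b    : ∀ i j → b i j ≡ false → Edge a b (y¹ i) (y² j)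

-- a subgraph is given by a duplicate-free list of directed edges (u , v)
EdgeList : ℕ → ℕ → Set
EdgeList ℓ β = List (Vertex ℓ β × Vertex ℓ β)

data Walk {ℓ β : ℕ} (H : EdgeList ℓ β) : Vertex ℓ β → Vertex ℓ β → ℕ → Set where
  [] : ∀ {u} → Walk H u u zero
  _∷_ : ∀ {u w v n} → (u , w) ∈ H → Walk H w v n → Walk H u v (suc n)

-- a directed path of at most k edges from u to v in H
-- (existence of such a path is equivalent to existence of such a walk)
PathWithin : {ℓ β : ℕ} → EdgeList ℓ β → ℕ → Vertex ℓ β → Vertex ℓ β → Set
PathWithin H k u v = Σ ℕ λ n → (n ≤ k) × Walk H u v n

IsSpanner : {ℓ β : ℕ} → Matrix ℓ → Matrix ℓ → ℕ → EdgeList ℓ β → Set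
IsSpanner {ℓ} {β} a b k H =
  Unique H
  × (∀ {u v} → (u , v) ∈ H → Edge a b u v)
  × (∀ {u v} → Edge a b u v → PathWithin H k u v)

isD : {ℓ β : ℕ} → Vertex ℓ β × Vertex ℓ β → Bool
isD (x _ _ , y _ _) = true
isD _ = false

countD : {ℓ β : ℕ} → EdgeList ℓ β → ℕ
countD H = length (filterᵇ isD H)

-- The y_rs are sinks, so a path from x_ij to y_rs other than the edge itself enters x¹_i
-- and continues to x²_r' (needing a_ir' = 0) or via y¹_i to y²_r' (needing b_ir' = 0);
-- from there only y-vertices of row r' are reachable. Hence if a_ir = b_ir = 1, a
-- spanner keeps all β² edges x_ij → y_rs. If a and b are disjoint, each D-edge
-- x_ij → y_rs is spanned by x_ij x¹_i x²_r y²_r y³_r y_rs or x_ij x¹_i y¹_i y²_r y³_r y_rs,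
-- so the 2ℓβ + 3ℓ + 2ℓ² ≤ 7ℓβ edges outside D form a 5-spanner.
module Submission where

open import Defs
open import Data.Bool using (Bool; true; false)
open import Data.Bool.Properties using (not-¬; T?) renaming (_≟_ to _≟ᵇ_)
open import Data.Empty using (⊥-elim)
open import Data.Fin using (Fin; zero; suc) renaming (_≟_ to _≟ᶠ_)
open import Data.List using (List; []; _∷_; _++_; concat; length; map; filter; filterᵇ; cartesianProduct; allFin; deduplicate)
open import Data.List.Membership.Propositional using (_∈_)
open import Data.List.Membership.Propositional.Properties
  using (∈-map⁺; ∈-map⁻; ∈-++⁺ˡ; ∈-++⁺ʳ; ∈-++⁻; ∈-∃++; ∈-filter⁺; ∈-concat⁺′; ∈-allFin; ∈-cartesianProduct⁺; ∈-deduplicate⁺; ∈-deduplicate⁻)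
open import Data.List.Properties using (length-++; length-map; length-filter; length-deduplicate; length-tabulate)
open import Data.List.Relation.Unary.All as All using (All; []; _∷_)
open import Data.List.Relation.Unary.AllPairs using (_∷_)
open import Data.List.Relation.Unary.All.Properties using (map⁺; concat⁺; all-filter)
open import Data.List.Relation.Unary.Any using (here; there)
open import Data.List.Relation.Unary.Unique.Propositional using (Unique)
import Data.List.Relation.Unary.Unique.Propositional.Properties as Unique
open import Data.List.Relation.Unary.Unique.DecPropositional.Properties using (deduplicate-!)
open import Data.Nat using (ℕ; suc; _+_; _*_; _≤_; _≤?_; z≤n; s≤s)
open import Data.Nat.Properties using (≤-trans; ≤-reflexive; +-mono-≤; +-suc; *-assoc; *-monoʳ-≤; *-identityʳ; module ≤-Reasoning)
open import Data.Product using (_×_; _,_; Σ; uncurry)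
open import Data.Product.Properties using () renaming (≡-dec to ×-≡-dec)
open import Data.Sum using (_⊎_; inj₁; inj₂)
open import Data.Sum.Properties using () renaming (≡-dec to ⊎-≡-dec)
open import Function using (_∘_)
open import Function.Bundles using (mk↣)
open import Relation.Binary.Definitions using (DecidableEquality)
open import Relation.Binary.PropositionalEquality using (_≡_; refl; sym; trans; cong; cong₂; module ≡-Reasoning)
open import Relation.Nullary using (¬_; Dec)
open import Relation.Nullary.Decidable using (via-injection; decidable-stable)

module _ {A : Set} where

  unique-⊆⇒length≤ : {xs ys : List A} → Unique xs → (∀ {z} → z ∈ xs → z ∈ ys) → length xs ≤ length ys
  unique-⊆⇒length≤ {[]} _ _ = z≤n
  unique-⊆⇒length≤ {v ∷ xs} {ys} (v∉xs ∷ xs!) xs⊆ys with ∈-∃++ (xs⊆ys (here refl))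
  ... | ps , qs , refl = begin
    suc (length xs)          ≤⟨ s≤s (unique-⊆⇒length≤ xs! xs⊆ps++qs) ⟩
    suc (length (ps ++ qs))  ≡⟨ cong suc (length-++ ps) ⟩
    suc (length ps + length qs) ≡⟨ sym (+-suc (length ps) (length qs)) ⟩
    length ps + length (v ∷ qs) ≡⟨ sym (length-++ ps) ⟩
    length (ps ++ v ∷ qs)    ∎
    where
    open ≤-Reasoning
    xs⊆ps++qs : ∀ {z} → z ∈ xs → z ∈ ps ++ qs
    xs⊆ps++qs z∈xs with ∈-++⁻ ps (xs⊆ys (there z∈xs))
    ... | inj₁ z∈ps = ∈-++⁺ˡ z∈ps
    ... | inj₂ (here refl) = ⊥-elim (All.lookup v∉xs z∈xs refl)
    ... | inj₂ (there z∈qs) = ∈-++⁺ʳ ps z∈qs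

  length-++-≤ : {xs ys : List A} {m n : ℕ} → length xs ≤ m → length ys ≤ n → length (xs ++ ys) ≤ m + n
  length-++-≤ {xs} xs≤m ys≤n = ≤-trans (≤-reflexive (length-++ xs)) (+-mono-≤ xs≤m ys≤n)

  length-concat-≤ : {xss : List (List A)} {m : ℕ} → All (λ xs → length xs ≤ m) xss → length (concat xss) ≤ length xss * m
  length-concat-≤ [] = z≤n
  length-concat-≤ {xs ∷ _} (xs≤m ∷ xss≤m) = length-++-≤ {xs} xs≤m (length-concat-≤ xss≤m)

pairs : (m n : ℕ) → List (Fin m × Fin n)
pairs m n = cartesianProduct (allFin m) (allFin n)

∈-pairs : {m n : ℕ} (i : Fin m) (j : Fin n) → (i , j) ∈ pairs m n
∈-pairs i j = ∈-cartesianProduct⁺ (∈-allFin i) (∈-allFin j)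

pairs-unique : (m n : ℕ) → Unique (pairs m n)
pairs-unique m n = Unique.cartesianProduct⁺ (Unique.allFin⁺ m) (Unique.allFin⁺ n)

length-cartesianProduct : {A B : Set} (xs : List A) (ys : List B) →
  length (cartesianProduct xs ys) ≡ length xs * length ys
length-cartesianProduct [] ys = refl
length-cartesianProduct (v ∷ xs) ys = begin
  length (map (v ,_) ys ++ cartesianProduct xs ys)        ≡⟨ length-++ (map (v ,_) ys) ⟩
  length (map (v ,_) ys) + length (cartesianProduct xs ys) ≡⟨ cong₂ _+_ (length-map (v ,_) ys) (length-cartesianProduct xs ys) ⟩
  length ys + length xs * length ys                        ∎
  where open ≡-Reasoning

length-pairs : (m n : ℕ) → length (pairs m n) ≡ m * n
length-pairs m n = trans (length-cartesianProduct (allFin m) (allFin n))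
  (cong₂ _*_ (length-tabulate {n = m} (λ i → i)) (length-tabulate {n = n} (λ j → j)))

module _ {ℓ β : ℕ} where

  private
    Code : Set
    Code = (Fin 5 × Fin ℓ) ⊎ (Bool × Fin ℓ × Fin β)

    encode : Vertex ℓ β → Code
    encode (x¹ i) = inj₁ (zero , i)
    encode (x² i) = inj₁ (suc zero , i)
    encode (y¹ i) = inj₁ (suc (suc zero) , i)
    encode (y² i) = inj₁ (suc (suc (suc zero)) , i)
    encode (y³ i) = inj₁ (suc (suc (suc (suc zero))) , i)
    encode (x i j) = inj₂ (false , i , j)
    encode (y i j) = inj₂ (true , i , j)

    decode : Code → Vertex ℓ β
    decode (inj₁ (zero , i)) = x¹ i
    decode (inj₁ (suc zero , i)) = x² i
    decode (inj₁ (suc (suc zero) , i)) = y¹ i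
    decode (inj₁ (suc (suc (suc zero)) , i)) = y² i
    decode (inj₁ (suc (suc (suc (suc zero))) , i)) = y³ i
    decode (inj₂ (false , i , j)) = x i j
    decode (inj₂ (true , i , j)) = y i j

    decode-encode : ∀ v → decode (encode v) ≡ v
    decode-encode (x¹ _) = refl
    decode-encode (x² _) = refl
    decode-encode (y¹ _) = refl
    decode-encode (y² _) = refl
    decode-encode (y³ _) = refl
    decode-encode (x _ _) = refl
    decode-encode (y _ _) = refl

    encode-injective : ∀ {u v} → encode u ≡ encode v → u ≡ v
    encode-injective {u} {v} eq = trans (sym (decode-encode u)) (trans (cong decode eq) (decode-encode v))

    _≟ᶜ_ : DecidableEquality Code
    _≟ᶜ_ = ⊎-≡-dec (×-≡-dec _≟ᶠ_ _≟ᶠ_) (×-≡-dec _≟ᵇ_ (×-≡-dec _≟ᶠ_ _≟ᶠ_))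

  _≟ᵛ_ : DecidableEquality (Vertex ℓ β)
  _≟ᵛ_ = via-injection (mk↣ encode-injective) _≟ᶜ_

  _≟ᵉ_ : DecidableEquality (Vertex ℓ β × Vertex ℓ β)
  _≟ᵉ_ = ×-≡-dec _≟ᵛ_ _≟ᵛ_

module Reachability {ℓ β : ℕ} {a b : Matrix ℓ} {H : EdgeList ℓ β}
  (H⊆G : ∀ {u v} → (u , v) ∈ H → Edge a b u v) where

  y-sink : ∀ {p q v n} → Walk H (y p q) v n → v ≡ y p q
  y-sink [] = refl
  y-sink (e ∷ _) with H⊆G e
  ... | ()

  y³-reaches-y : ∀ {p r s n} → Walk H (y³ p) (y r s) n → p ≡ r
  y³-reaches-y (e ∷ w) with H⊆G e
  ... | e-y³y _ _ with y-sink w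
  ... | refl = refl

  y²-reaches-y : ∀ {p r s n} → Walk H (y² p) (y r s) n → p ≡ r
  y²-reaches-y (e ∷ w) with H⊆G e
  ... | e-y²y³ _ = y³-reaches-y w

  x²-reaches-y : ∀ {p r s n} → Walk H (x² p) (y r s) n → p ≡ r
  x²-reaches-y (e ∷ w) with H⊆G e
  ... | e-x²y² _ = y²-reaches-y w

  y¹-reaches-y : ∀ {i r s n} → Walk H (y¹ i) (y r s) n → b i r ≡ false
  y¹-reaches-y (e ∷ w) with H⊆G e
  ... | e-b _ _ b≡0 with y²-reaches-y w
  ... | refl = b≡0

  x¹-reaches-y : ∀ {i r s n} → Walk H (x¹ i) (y r s) n → a i r ≡ false ⊎ b i r ≡ false
  x¹-reaches-y (e ∷ w) with H⊆G e
  ... | e-x¹y¹ _ = inj₂ (y¹-reaches-y w)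
  ... | e-a _ _ a≡0 with x²-reaches-y w
  ... | refl = inj₁ a≡0

  x-reaches-y : ∀ {i j r s n} → Walk H (x i j) (y r s) n → (x i j , y r s) ∈ H ⊎ (a i r ≡ false ⊎ b i r ≡ false)
  x-reaches-y (e ∷ w) with H⊆G e
  ... | e-xx¹ _ _ = inj₂ (x¹-reaches-y w)
  ... | e-D _ _ _ _ with y-sink w
  ... | refl = inj₁ e

spanner-keeps-D-edges : {ℓ β k : ℕ} {a b : Matrix ℓ} {H : EdgeList ℓ β} → IsSpanner a b k H →
  {i r : Fin ℓ} → a i r ≡ true → b i r ≡ true → ∀ j s → (x i j , y r s) ∈ H
spanner-keeps-D-edges (_ , H⊆G , spans) {i} {r} a≡1 b≡1 j s with spans (e-D i j r s)
... | _ , _ , w with Reachability.x-reaches-y H⊆G w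
... | inj₁ e = e
... | inj₂ (inj₁ a≡0) = ⊥-elim (not-¬ a≡1 a≡0)
... | inj₂ (inj₂ b≡0) = ⊥-elim (not-¬ b≡1 b≡0)

module _ {ℓ β : ℕ} (i r : Fin ℓ) where

  D-edge : Fin β × Fin β → Vertex ℓ β × Vertex ℓ β
  D-edge (j , s) = x i j , y r s

  D-edge-injective : ∀ {p q} → D-edge p ≡ D-edge q → p ≡ q
  D-edge-injective {_ , _} {_ , _} refl = refl

  D-edges⊆H⇒countD≥β² : (H : EdgeList ℓ β) → (∀ j s → (x i j , y r s) ∈ H) → β * β ≤ countD H
  D-edges⊆H⇒countD≥β² H D⊆H = begin
    β * β                             ≡⟨ sym (length-pairs β β) ⟩
    length (pairs β β)                ≡⟨ sym (length-map D-edge (pairs β β)) ⟩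
    length (map D-edge (pairs β β))   ≤⟨ unique-⊆⇒length≤ D-edges-unique D⊆D∩H ⟩
    countD H                          ∎
    where
    open ≤-Reasoning
    D-edges-unique : Unique (map D-edge (pairs β β))
    D-edges-unique = Unique.map⁺ D-edge-injective (pairs-unique β β)
    D⊆D∩H : ∀ {e} → e ∈ map D-edge (pairs β β) → e ∈ filterᵇ isD H
    D⊆D∩H e∈D with ∈-map⁻ D-edge e∈D
    ... | (j , s) , _ , refl = ∈-filter⁺ (T? ∘ isD) (D⊆H j s) _

-- ¬ Disjoint yields the witness (i , r) only under ¬¬, which the decidable goal absorbs.
spanner-countD≥β² : {ℓ β k : ℕ} {a b : Matrix ℓ} → ¬ Disjoint a b →
  (H : EdgeList ℓ β) → IsSpanner a b k H → β * β ≤ countD H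
spanner-countD≥β² {β = β} ¬disjoint H H-spanner = decidable-stable (β * β ≤? countD H)
  λ count<β² → ¬disjoint λ (i , r , a≡1 , b≡1) →
    count<β² (D-edges⊆H⇒countD≥β² i r H (spanner-keeps-D-edges H-spanner a≡1 b≡1))

module Construction {ℓ β : ℕ} (a b : Matrix ℓ) where

  zero-entry? : (c : Matrix ℓ) (p : Fin ℓ × Fin ℓ) → Dec (uncurry c p ≡ false)
  zero-entry? c p = uncurry c p ≟ᵇ false

  zeros : Matrix ℓ → List (Fin ℓ × Fin ℓ)
  zeros c = filter (zero-entry? c) (pairs ℓ ℓ)

  private
    xx¹ y³y : Fin ℓ × Fin β → Vertex ℓ β × Vertex ℓ β
    xx¹ (i , j) = x i j , x¹ i
    y³y (i , j) = y³ i , y i j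

    x¹y¹ x²y² y²y³ : Fin ℓ → Vertex ℓ β × Vertex ℓ β
    x¹y¹ i = x¹ i , y¹ i
    x²y² i = x² i , y² i
    y²y³ i = y² i , y³ i

    x¹x² y¹y² : Fin ℓ × Fin ℓ → Vertex ℓ β × Vertex ℓ β
    x¹x² (i , j) = x¹ i , x² j
    y¹y² (i , j) = y¹ i , y² j

  blocks : List (EdgeList ℓ β)
  blocks =
    map xx¹ (pairs ℓ β) ∷ map y³y (pairs ℓ β) ∷
    map x¹y¹ (allFin ℓ) ∷ map x²y² (allFin ℓ) ∷ map y²y³ (allFin ℓ) ∷
    map x¹x² (zeros a) ∷ map y¹y² (zeros b) ∷ []

  edges-outside-D : EdgeList ℓ β
  edges-outside-D = concat blocks

  blocks⊆G : All (All (uncurry (Edge a b))) blocks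
  blocks⊆G =
    map⁺ (All.universal (λ (i , j) → e-xx¹ i j) (pairs ℓ β)) ∷
    map⁺ (All.universal (λ (i , j) → e-y³y i j) (pairs ℓ β)) ∷
    map⁺ (All.universal e-x¹y¹ (allFin ℓ)) ∷
    map⁺ (All.universal e-x²y² (allFin ℓ)) ∷
    map⁺ (All.universal e-y²y³ (allFin ℓ)) ∷
    map⁺ (All.map (λ {(i , j)} → e-a i j) (all-filter (zero-entry? a) (pairs ℓ ℓ))) ∷
    map⁺ (All.map (λ {(i , j)} → e-b i j) (all-filter (zero-entry? b) (pairs ℓ ℓ))) ∷ []

  blocks-small : 1 ≤ β → ℓ ≤ β → All (λ es → length es ≤ ℓ * β) blocks
  blocks-small 1≤β ℓ≤β =
    pairs-block xx¹ ∷ pairs-block y³y ∷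
    allFin-block x¹y¹ ∷ allFin-block x²y² ∷ allFin-block y²y³ ∷
    zeros-block x¹x² a ∷ zeros-block y¹y² b ∷ []
    where
    open ≤-Reasoning
    pairs-block : (f : Fin ℓ × Fin β → Vertex ℓ β × Vertex ℓ β) → length (map f (pairs ℓ β)) ≤ ℓ * β
    pairs-block f = ≤-reflexive (trans (length-map f (pairs ℓ β)) (length-pairs ℓ β))
    allFin-block : (f : Fin ℓ → Vertex ℓ β × Vertex ℓ β) → length (map f (allFin ℓ)) ≤ ℓ * β
    allFin-block f = begin
      length (map f (allFin ℓ)) ≡⟨ length-map f (allFin ℓ) ⟩
      length (allFin ℓ)         ≡⟨ length-tabulate {n = ℓ} (λ i → i) ⟩
      ℓ                         ≡⟨ sym (*-identityʳ ℓ) ⟩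
      ℓ * 1                     ≤⟨ *-monoʳ-≤ ℓ 1≤β ⟩
      ℓ * β                     ∎
    zeros-block : (f : Fin ℓ × Fin ℓ → Vertex ℓ β × Vertex ℓ β) (c : Matrix ℓ) → length (map f (zeros c)) ≤ ℓ * β
    zeros-block f c = begin
      length (map f (zeros c)) ≡⟨ length-map f (zeros c) ⟩
      length (zeros c)         ≤⟨ length-filter (zero-entry? c) (pairs ℓ ℓ) ⟩
      length (pairs ℓ ℓ)       ≡⟨ length-pairs ℓ ℓ ⟩
      ℓ * ℓ                    ≤⟨ *-monoʳ-≤ ℓ ℓ≤β ⟩
      ℓ * β                    ∎

  H : EdgeList ℓ β
  H = deduplicate _≟ᵉ_ edges-outside-D

  H-unique : Unique H
  H-unique = deduplicate-! _≟ᵉ_ edges-outside-D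

  H⊆G : ∀ {u v} → (u , v) ∈ H → Edge a b u v
  H⊆G e = All.lookup (concat⁺ blocks⊆G) (∈-deduplicate⁻ _≟ᵉ_ edges-outside-D e)

  length-H : 1 ≤ β → ℓ ≤ β → length H ≤ 7 * (ℓ * β)
  length-H 1≤β ℓ≤β = ≤-trans (length-deduplicate _≟ᵉ_ edges-outside-D) (length-concat-≤ (blocks-small 1≤β ℓ≤β))

  private
    ∈H : ∀ {e es} → e ∈ es → es ∈ blocks → e ∈ H
    ∈H e∈es es∈blocks = ∈-deduplicate⁺ _≟ᵉ_ (∈-concat⁺′ e∈es es∈blocks)

  edge-outside-D∈H : ∀ {u v} → Edge a b u v → isD (u , v) ≡ false → (u , v) ∈ H
  edge-outside-D∈H (e-D _ _ _ _) ()
  edge-outside-D∈H (e-xx¹ i j) _ = ∈H (∈-map⁺ xx¹ (∈-pairs i j)) (here refl)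
  edge-outside-D∈H (e-y³y i j) _ = ∈H (∈-map⁺ y³y (∈-pairs i j)) (there (here refl))
  edge-outside-D∈H (e-x¹y¹ i) _ = ∈H (∈-map⁺ x¹y¹ (∈-allFin i)) (there (there (here refl)))
  edge-outside-D∈H (e-x²y² i) _ = ∈H (∈-map⁺ x²y² (∈-allFin i)) (there (there (there (here refl))))
  edge-outside-D∈H (e-y²y³ i) _ = ∈H (∈-map⁺ y²y³ (∈-allFin i)) (there (there (there (there (here refl)))))
  edge-outside-D∈H (e-a i j a≡0) _ =
    ∈H (∈-map⁺ x¹x² (∈-filter⁺ (zero-entry? a) (∈-pairs i j) a≡0)) (there (there (there (there (there (here refl))))))
  edge-outside-D∈H (e-b i j b≡0) _ =
    ∈H (∈-map⁺ y¹y² (∈-filter⁺ (zero-entry? b) (∈-pairs i j) b≡0)) (there (there (there (there (there (there (here refl)))))))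

  H-spanner : {k : ℕ} → 5 ≤ k → Disjoint a b → IsSpanner a b k H
  H-spanner {k} 5≤k disjoint = H-unique , H⊆G , spans
    where
    step : ∀ {u v} → Edge a b u v → isD (u , v) ≡ false → (u , v) ∈ H
    step = edge-outside-D∈H

    direct : ∀ {u v} → Edge a b u v → isD (u , v) ≡ false → PathWithin H k u v
    direct e outside = 1 , ≤-trans (s≤s z≤n) 5≤k , step e outside ∷ []

    spans : ∀ {u v} → Edge a b u v → PathWithin H k u v
    spans (e-D i j r s) with a i r in a≡ | b i r in b≡
    ... | false | _ = 5 , 5≤k ,
      step (e-xx¹ i j) refl ∷ step (e-a i r a≡) refl ∷ step (e-x²y² r) refl ∷
      step (e-y²y³ r) refl ∷ step (e-y³y r s) refl ∷ []
    ... | true | false = 5 , 5≤k ,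
      step (e-xx¹ i j) refl ∷ step (e-x¹y¹ i) refl ∷ step (e-b i r b≡) refl ∷
      step (e-y²y³ r) refl ∷ step (e-y³y r s) refl ∷ []
    ... | true | true = ⊥-elim (disjoint (i , r , a≡ , b≡))
    spans e@(e-xx¹ _ _) = direct e refl
    spans e@(e-y³y _ _) = direct e refl
    spans e@(e-x¹y¹ _) = direct e refl
    spans e@(e-x²y² _) = direct e refl
    spans e@(e-y²y³ _) = direct e refl
    spans e@(e-a _ _ _) = direct e refl
    spans e@(e-b _ _ _) = direct e refl

lemma6 : (ℓ β k : ℕ) → 1 ≤ ℓ → ℓ ≤ β → 5 ≤ k → (a b : Matrix ℓ) →
    (Disjoint a b →
      Σ (EdgeList ℓ β) λ H → IsSpanner {ℓ} {β} a b k H × (length H ≤ 7 * ℓ * β))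
    × (¬ Disjoint a b →
      (H : EdgeList ℓ β) → IsSpanner {ℓ} {β} a b k H → β * β ≤ countD H)
lemma6 ℓ β k 1≤ℓ ℓ≤β 5≤k a b = sparse-spanner , spanner-countD≥β²
  where
  open Construction {ℓ} {β} a b
  sparse-spanner : Disjoint a b → Σ (EdgeList ℓ β) λ H → IsSpanner a b k H × (length H ≤ 7 * ℓ * β)
  sparse-spanner disjoint = H , H-spanner 5≤k disjoint ,
    ≤-trans (length-H (≤-trans 1≤ℓ ℓ≤β) ℓ≤β) (≤-reflexive (sym (*-assoc 7 ℓ β)))
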